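{- Let $m>1$ be an integer and let $F=[m_1,m_2,\ldots,m_t]$ be a bipartite directed $2$-factor of order $2m$ with $m_1\le m_2\le\cdots\le m_t$, and suppose that $F$ has $s\ge 1$ directed cycles of length two. Then there exists an $F$-factorization of $H^*_{2m}$.
   Context: A directed $2$-factor $[m_1,\ldots,m_t]$ of order $m_1+\cdots+m_t$ is a digraph consisting of vertex-disjoint directed cycles of lengths $m_1,\ldots,m_t$ (each $m_i\ge2$; a directed $2$-cycle on $\{u,v\}$ consists of arcs $uv$ and $vu$); it is bipartite if all $m_i$ are even. $H_{2m}$ is the lexicographic product $C_m[\overline{K_2}]$: its vertex set is $\{x_i,y_i : i\in\mathbb{Z}_m\}$, and each of $x_i,y_i$ is adjacent to each of $x_{i+1},y_{i+1}$ (indices mod $m$), where $C_m$ is the cycle on $\mathbb{Z}_m$. For a graph $G$, $G^*$ is the digraph obtained by replacing each edge $\{u,v\}$ by the two arcs $uv$ and $vu$. An $F$-factorization of a digraph $D$ is a partition of the arc set of $D$ into spanning subdigraphs each isomorphic to $F$. -}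

module Defs where

open import Data.Nat using (ℕ; zero; suc; _*_)
open import Data.Fin using (Fin; zero; suc)
open import Data.Bool using (Bool)
open import Data.Maybe using (Maybe; just; nothing; fromMaybe)
import Data.Maybe as Maybe
open import Data.List using (List; length; lookup)
open import Data.Product using (Σ; _×_; _,_; proj₁; proj₂)
open import Data.Sum using (_⊎_)
open import Relation.Binary.PropositionalEquality using (_≡_)
open import Function.Bundles using (_↔_; Inverse; _⇔_)

Digraph : Set → Set₁
Digraph V = V → V → Set

-- Cyclic successor on Fin n (i ↦ i + 1 mod n).
nextFin : ∀ {n} → Fin n → Maybe (Fin n)
nextFin {suc zero} zero = nothing
nextFin {suc (suc n)} zero = just (suc zero)
nextFin {suc (suc n)} (suc i) = Maybe.map suc (nextFin i)

cyc : ∀ {n} → Fin n → Fin n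
cyc {suc n} i = fromMaybe zero (nextFin i)

-- The directed 2-factor [m₁,…,m_t]: vertices are pairs (j , a) with j a
-- cycle index and a ∈ ℤ_{m_j}; arcs (j , a) → (j , a + 1 mod m_j).
-- (For m_j = 2 this gives both arcs of a directed 2-cycle.)
FVert : List ℕ → Set
FVert ms = Σ (Fin (length ms)) (λ j → Fin (lookup ms j))

FArc : (ms : List ℕ) → Digraph (FVert ms)
FArc ms (j , a) (k , b) = Σ (j ≡ k) (λ { _≡_.refl → b ≡ cyc a })

-- H_{2m} = C_m[K̄₂]: vertices (i , false) = x_i, (i , true) = y_i, i ∈ ℤ_m.
HVert : ℕ → Set
HVert m = Fin m × Bool

CAdj : ∀ {m} → Fin m → Fin m → Set
CAdj i j = (j ≡ cyc i) ⊎ (i ≡ cyc j)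

HStarArc : (m : ℕ) → Digraph (HVert m)
HStarArc m (i , _) (j , _) = CAdj i j

Iso : ∀ {V W : Set} → Digraph V → Digraph W → Set
Iso {V} {W} D E = Σ (V ↔ W) (λ φ → ∀ p q → D p q ⇔ E (Inverse.to φ p) (Inverse.to φ q))

Factorization : ∀ {U V : Set} → Digraph V → Digraph U → Set₁
Factorization {U} {V} D F =
  Σ ℕ λ k → Σ (Fin k → Digraph V) λ Fs →
    (∀ i → Iso F (Fs i)) ×
    (∀ i u v → Fs i u v → D u v) ×
    (∀ u v → D u v → Σ (Fin k) λ i → Fs i u v × (∀ j → Fs j u v → j ≡ i))

{-# OPTIONS --safe #-}
-- Lay out each cycle of F, of length 2ℓ, as a ladder on ℓ consecutive positions of C_m: forwards
-- along the x-row, then backwards along the y-row. After moving the whole y-row one position forward,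
-- every arc of the laid-out F leaves x_i towards position i + 1 and y_i towards position i − 1, so F
-- becomes a spanning subdigraph of H*_{2m}. The other factors are its conjugates by switches, which
-- exchange x_i and y_i at a chosen set of positions. For m ≥ 3, colour C_m properly with the three
-- nonzero linear forms f_i on 𝔽₂² and let k ∈ 𝔽₂² switch position i iff f_i(k) = 1. An arc from
-- position i to j = i ± 1 (the sign is determined by j as m ≥ 3) lies in the k-th conjugate iff f_i(k)
-- and f_j(k) take two prescribed values; since f_i ≠ f_j form a basis of the dual, exactly one k does.
-- For m = 2 the laid-out F and its conjugate by the switch at position 0 already partition the arcs.

module Submission where

open import Defs
open import Data.Nat using (ℕ; zero; suc; _+_; _*_; _∸_; _≤_; _<_; s≤s; z≤n)
open import Data.Nat.Properties
  using (≤-totalOrder; suc-injective; 0≢1+n; m≢1+n+m; n≮0; <-irrefl; <⇒≱; ≤⇒≯; ≤-reflexive; ≤-trans;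
         m≤m+n; n≤1+n; n≤0⇒n≡0; m+n≡0⇒m≡0; +-suc; +-identityʳ; +-cancelˡ-≡; +-cancelʳ-≡; m∸n+n≡m;
         *-suc; *-identityʳ; *-distribˡ-+; *-cancelˡ-≡)
open import Data.Nat.Divisibility using (_∣_; divides)
open import Data.Nat.ListAction using (sum)
open import Data.Fin using (Fin; zero; suc; toℕ; fromℕ; inject₁; opposite; splitAt; _↑ˡ_; _↑ʳ_)
open import Data.Fin.Properties
  using (toℕ-injective; toℕ<n; toℕ-fromℕ; toℕ-inject₁; toℕ-↑ˡ; toℕ-↑ʳ; splitAt-↑ˡ; splitAt-↑ʳ;
         splitAt⁻¹-↑ˡ; splitAt⁻¹-↑ʳ; opposite-prop; opposite-involutive; +↔⊎; *↔×; 2↔Bool)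
open import Data.Maybe using (Maybe; just; nothing; fromMaybe)
open import Data.Bool using (Bool; true; false; if_then_else_; _xor_)
open import Data.Bool.Properties using (xor-assoc; xor-same; xor-identityʳ)
open import Data.List using (List; []; _∷_; map)
open import Data.List.Relation.Unary.All using (All; []; _∷_)
open import Data.List.Relation.Unary.Sorted.TotalOrder using (Sorted)
open import Data.List.Membership.Propositional using (_∈_)
open import Data.Product using (Σ; ∃; ∃!; _×_; _,_; proj₁; proj₂; map₁)
open import Data.Product.Function.NonDependent.Propositional using (_×-↔_)
open import Data.Sum using (_⊎_; inj₁; inj₂; [_,_]′)
open import Data.Empty using (⊥; ⊥-elim)
open import Function.Base using (_∘_)
open import Function.Bundles using (_↔_; Inverse; mk↔ₛ′; _⇔_; mk⇔; Equivalence; Injection)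
open import Function.Properties.Inverse using (↔⇒↣; ↔-trans; ↔-sym)
open import Relation.Binary.PropositionalEquality
open ≡-Reasoning

m+n≤m⇒n≡0 : ∀ m {n} → m + n ≤ m → n ≡ 0
m+n≤m⇒n≡0 zero    n≤0       = n≤0⇒n≡0 n≤0
m+n≤m⇒n≡0 (suc m) (s≤s m+n≤m) = m+n≤m⇒n≡0 m m+n≤m

xor-cancelˡ : ∀ x y → x xor (x xor y) ≡ y
xor-cancelˡ x y = trans (sym (xor-assoc x x y)) (cong (_xor y) (xor-same x))

xor-cancelʳ : ∀ x y → (x xor y) xor y ≡ x
xor-cancelʳ x y = trans (xor-assoc x y y) (trans (cong (x xor_) (xor-same y)) (xor-identityʳ x))

xor-solve : ∀ x {y z} → x xor y ≡ z → y ≡ x xor z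
xor-solve x {y} e = trans (sym (xor-cancelˡ x y)) (cong (x xor_) e)

xor-unique : ∀ x z → ∃! _≡_ (λ y → x xor y ≡ z)
xor-unique x z = x xor z , xor-cancelˡ x z , λ e → sym (xor-solve x e)

∃!-cong : ∀ {A : Set} {P Q : A → Set} → (∀ x → P x ⇔ Q x) → ∃! _≡_ P → ∃! _≡_ Q
∃!-cong P⇔Q (x , Px , unique) =
  x , Equivalence.to (P⇔Q x) Px , λ Qy → unique (Equivalence.from (P⇔Q _) Qy)

-- Cyclic successor and predecessor on Fin n

private
  data NextView {n} (i : Fin n) : Maybe (Fin n) → Set where
    inner : ∀ {j} → toℕ j ≡ suc (toℕ i) → NextView i (just j)
    last  : suc (toℕ i) ≡ n → NextView i nothing

  nextView : ∀ {n} (i : Fin n) → NextView i (nextFin i)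
  nextView {suc zero}    zero    = last refl
  nextView {suc (suc n)} zero    = inner refl
  nextView {suc (suc n)} (suc i) with nextFin i | nextView i
  ... | just _  | inner e = inner (cong suc e)
  ... | nothing | last e  = last (cong suc e)

data CycView {n} (i : Fin n) : Set where
  inner : toℕ (cyc i) ≡ suc (toℕ i) → CycView i
  wrap  : toℕ (cyc i) ≡ 0 → suc (toℕ i) ≡ n → CycView i

cycView : ∀ {n} (i : Fin n) → CycView i
cycView {suc n} i with nextFin i in eq | nextView i
... | just _  | inner e = inner (trans (cong (λ m → toℕ (fromMaybe zero m)) eq) e)
... | nothing | last e  = wrap (cong (λ m → toℕ (fromMaybe zero m)) eq) e

cyc-unique : ∀ {n} {i j : Fin n} → toℕ j ≡ suc (toℕ i) → j ≡ cyc i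
cyc-unique {i = i} {j} e with cycView i
... | inner e′   = toℕ-injective (trans e (sym e′))
... | wrap _ i+1≡n = ⊥-elim (<-irrefl (trans e i+1≡n) (toℕ<n j))

cyc-injective : ∀ {n} {i j : Fin n} → cyc i ≡ cyc j → i ≡ j
cyc-injective {i = i} {j} e with cycView i | cycView j
... | inner a  | inner b  = toℕ-injective (suc-injective (trans (sym a) (trans (cong toℕ e) b)))
... | inner a  | wrap b _ = ⊥-elim (0≢1+n (trans (sym b) (trans (sym (cong toℕ e)) a)))
... | wrap a _ | inner b  = ⊥-elim (0≢1+n (trans (sym a) (trans (cong toℕ e) b)))
... | wrap _ a | wrap _ b = toℕ-injective (suc-injective (trans a (sym b)))

prd : ∀ {n} → Fin n → Fin n
prd {suc n} zero    = fromℕ n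
prd {suc n} (suc i) = inject₁ i

cyc-prd : ∀ {n} (i : Fin n) → cyc (prd i) ≡ i
cyc-prd {suc n} zero with cycView (fromℕ n)
... | inner e  = ⊥-elim (<-irrefl refl (subst (_< suc n) (trans e (cong suc (toℕ-fromℕ n))) (toℕ<n _)))
... | wrap e _ = toℕ-injective e
cyc-prd {suc n} (suc i) = sym (cyc-unique (cong suc (sym (toℕ-inject₁ i))))

prd-cyc : ∀ {n} (i : Fin n) → prd (cyc i) ≡ i
prd-cyc i = cyc-injective (cyc-prd (cyc i))

cyc∘cyc≢id : ∀ {n} → 3 ≤ n → (i : Fin n) → cyc (cyc i) ≢ i
cyc∘cyc≢id {n} 3≤n i e = impossible (cycView i) (cycView (cyc i))
  where
    i≡ : toℕ (cyc (cyc i)) ≡ toℕ i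
    i≡ = cong toℕ e

    n≰2 : n ≤ 2 → ⊥
    n≰2 n≤2 = ≤⇒≯ n≤2 3≤n

    impossible : CycView i → CycView (cyc i) → ⊥
    impossible (inner a) (inner b) = m≢1+n+m (toℕ i) (trans (sym i≡) (trans b (cong suc a)))
    impossible (inner a) (wrap b n≡) =
      n≰2 (≤-reflexive (trans (sym n≡) (cong suc (trans a (cong suc (trans (sym i≡) b))))))
    impossible (wrap a n≡) (inner b) =
      n≰2 (≤-reflexive (trans (sym n≡) (cong suc (trans (sym i≡) (trans b (cong suc a))))))
    impossible (wrap a _) (wrap _ n≡) =
      n≰2 (≤-trans (≤-reflexive (trans (sym n≡) (cong suc a))) (n≤1+n 1))

move : ∀ {n} → Bool → Fin n → Fin n
move false = cyc
move true  = prd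

move-adjacent : ∀ {n} c (i : Fin n) → CAdj i (move c i)
move-adjacent false i = inj₁ refl
move-adjacent true  i = inj₂ (sym (cyc-prd i))

adjacent⇒move : ∀ {n} {i j : Fin n} → CAdj i j → ∃ λ c → j ≡ move c i
adjacent⇒move (inj₁ e) = false , e
adjacent⇒move {j = j} (inj₂ e) = true , trans (sym (prd-cyc j)) (cong prd (sym e))

move-injective : ∀ {n} → 3 ≤ n → ∀ {c d} (i : Fin n) → move c i ≡ move d i → c ≡ d
move-injective _   {false} {false} i e = refl
move-injective _   {true}  {true}  i e = refl
move-injective 3≤n {false} {true}  i e = ⊥-elim (cyc∘cyc≢id 3≤n i (trans (cong cyc e) (cyc-prd i)))
move-injective 3≤n {true}  {false} i e = ⊥-elim (cyc∘cyc≢id 3≤n i (trans (cong cyc (sym e)) (cyc-prd i)))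

move≡cyc₂ : ∀ c (i : Fin 2) → move c i ≡ cyc i
move≡cyc₂ false i          = refl
move≡cyc₂ true  zero       = refl
move≡cyc₂ true  (suc zero) = refl

-- Factorizations into relabelled copies of a functional digraph

functional-factorization :
  ∀ {V W I : Set} {K : ℕ} {F : Digraph V} {D : Digraph W} (next : V → V) →
  (∀ p q → F p q ⇔ (q ≡ next p)) →
  (enum : Fin K ↔ I) (τ : I → W → W) (φ : I → V ↔ W) →
  (∀ i p → Inverse.to (φ i) (next p) ≡ τ i (Inverse.to (φ i) p)) →
  (∀ i u → D u (τ i u)) →
  (∀ u v → D u v → ∃! _≡_ (λ i → v ≡ τ i u)) →
  Factorization D F
functional-factorization {K = K} {F} {D} next F⇔next enum τ φ intertwines τ-arc cover =
  K , factor , iso , factor⊆D , partition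
  where
    open Inverse enum using (to; from; strictlyInverseˡ; strictlyInverseʳ)

    factor : Fin K → Digraph _
    factor k u v = v ≡ τ (to k) u

    iso : ∀ k → Iso F (factor k)
    iso k = φ (to k) , λ p q → mk⇔
      (λ pq → trans (cong φ→ (Equivalence.to (F⇔next p q) pq)) (intertwines (to k) p))
      (λ e → Equivalence.from (F⇔next p q) (φ-injective (trans e (sym (intertwines (to k) p)))))
      where
        φ→ = Inverse.to (φ (to k))
        φ-injective = Injection.injective (↔⇒↣ (φ (to k)))

    factor⊆D : ∀ k u v → factor k u v → D u v
    factor⊆D k u v refl = τ-arc (to k) u

    partition : ∀ u v → D u v → Σ (Fin K) λ k → factor k u v × (∀ k′ → factor k′ u v → k′ ≡ k)
    partition u v d with cover u v d
    ... | i , v≡τu , unique =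
      from i , trans v≡τu (cong (λ i → τ i u) (sym (strictlyInverseˡ i))) ,
      λ k′ v≡ → trans (sym (strictlyInverseʳ k′)) (cong from (sym (unique v≡)))

rotate : ∀ ms → FVert ms ↔ FVert ms
rotate ms = mk↔ₛ′ (λ (j , a) → j , cyc a) (λ (j , a) → j , prd a)
                  (λ (j , a) → cong (j ,_) (cyc-prd a)) (λ (j , a) → cong (j ,_) (prd-cyc a))

FArc⇔rotate : ∀ ms p q → FArc ms p q ⇔ (q ≡ Inverse.to (rotate ms) p)
FArc⇔rotate ms (j , a) (k , b) = mk⇔ (λ { (refl , refl) → refl }) (λ { refl → refl , refl })

-- The ladder layout of a bipartite 2-factor

data LadderStep {n : ℕ} : HVert n → HVert n → Set where
  right : ∀ {q q′} → toℕ q′ ≡ suc (toℕ q) → LadderStep (q , false) (q′ , false)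
  up    : ∀ {q} → LadderStep (q , false) (q , true)
  left  : ∀ {q q′} → toℕ q ≡ suc (toℕ q′) → LadderStep (q , true) (q′ , true)
  down  : ∀ {q} → LadderStep (q , true) (q , false)

LadderStep-translate : ∀ {m n} {f : Fin m → Fin n} c → (∀ q → toℕ (f q) ≡ c + toℕ q) →
                       ∀ {w w′} → LadderStep w w′ → LadderStep (map₁ f w) (map₁ f w′)
LadderStep-translate {f = f} c f≡ = λ
  { (right e) → right (shifted e) ; up → up ; (left e) → left (shifted e) ; down → down }
  where
    shifted : ∀ {q q′} → toℕ q′ ≡ suc (toℕ q) → toℕ (f q′) ≡ suc (toℕ (f q))
    shifted {q} {q′} e = begin
      toℕ (f q′)        ≡⟨ f≡ q′ ⟩
      c + toℕ q′        ≡⟨ cong (c +_) e ⟩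
      c + suc (toℕ q)   ≡⟨ +-suc c (toℕ q) ⟩
      suc (c + toℕ q)   ≡⟨ cong suc (f≡ q) ⟨
      suc (toℕ (f q))   ∎

rows : ∀ {ℓ} → (Fin ℓ ⊎ Fin ℓ) ↔ (Fin ℓ × Bool)
rows = mk↔ₛ′ [ (_, false) , (λ i → opposite i , true) ]′
             (λ { (i , false) → inj₁ i ; (i , true) → inj₂ (opposite i) })
             (λ { (i , false) → refl ; (i , true) → cong (_, true) (opposite-involutive i) })
             (λ { (inj₁ i) → refl ; (inj₂ i) → cong inj₂ (opposite-involutive i) })

rung : ∀ ℓ → Fin (ℓ + ℓ) ↔ (Fin ℓ × Bool)
rung ℓ = ↔-trans +↔⊎ rows

data RungView (ℓ : ℕ) (a : Fin (ℓ + ℓ)) : Fin ℓ × Bool → Set where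
  bottom : ∀ {i} → toℕ a ≡ toℕ i → RungView ℓ a (i , false)
  top    : ∀ {i r} → toℕ a ≡ ℓ + r → suc (toℕ i + r) ≡ ℓ → RungView ℓ a (i , true)

rungView : ∀ ℓ a → RungView ℓ a (Inverse.to (rung ℓ) a)
rungView ℓ a with splitAt ℓ a in eq
... | inj₁ i = bottom (trans (cong toℕ (sym (splitAt⁻¹-↑ˡ eq))) (toℕ-↑ˡ i ℓ))
... | inj₂ k = top (trans (cong toℕ (sym (splitAt⁻¹-↑ʳ eq))) (toℕ-↑ʳ ℓ k)) (begin
  suc (toℕ (opposite k) + toℕ k)   ≡⟨ +-suc _ (toℕ k) ⟨
  toℕ (opposite k) + suc (toℕ k)   ≡⟨ cong (_+ suc (toℕ k)) (opposite-prop k) ⟩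
  ℓ ∸ suc (toℕ k) + suc (toℕ k)    ≡⟨ m∸n+n≡m (toℕ<n k) ⟩
  ℓ                                ∎)

rung-step : ∀ ℓ a → LadderStep (Inverse.to (rung ℓ) a) (Inverse.to (rung ℓ) (cyc a))
rung-step ℓ a = step (rungView ℓ a) (rungView ℓ (cyc a)) (cycView a)
  where
    1+x≢ℓ+ℓ : ∀ {x} → x < ℓ → suc x ≢ ℓ + ℓ
    1+x≢ℓ+ℓ {x} x<ℓ e = n≮0 (subst (x <_) (m+n≤m⇒n≡0 ℓ (subst (_≤ ℓ) e x<ℓ)) x<ℓ)

    last-rung : ∀ {x y r} → x < ℓ → suc x ≡ ℓ + r → suc (y + r) ≡ ℓ → x ≡ y
    last-rung {x} {y} x<ℓ 1+x≡ℓ+r 1+y+r≡ℓ with refl ← m+n≤m⇒n≡0 ℓ (subst (_≤ ℓ) 1+x≡ℓ+r x<ℓ) =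
      suc-injective (begin
        suc x          ≡⟨ 1+x≡ℓ+r ⟩
        ℓ + 0          ≡⟨ +-identityʳ ℓ ⟩
        ℓ              ≡⟨ 1+y+r≡ℓ ⟨
        suc (y + 0)    ≡⟨ cong suc (+-identityʳ y) ⟩
        suc y          ∎)

    next-rung : ∀ {x y r r′} → suc (x + r) ≡ ℓ → suc (y + r′) ≡ ℓ → ℓ + r′ ≡ suc (ℓ + r) → x ≡ suc y
    next-rung {x} {y} {r} {r′} 1+x+r≡ℓ 1+y+r′≡ℓ ℓ+r′≡1+ℓ+r = +-cancelʳ-≡ r x (suc y) (begin
      x + r        ≡⟨ suc-injective (trans 1+x+r≡ℓ (sym 1+y+r′≡ℓ)) ⟩
      y + r′       ≡⟨ cong (y +_) (+-cancelˡ-≡ ℓ r′ (suc r) (trans ℓ+r′≡1+ℓ+r (sym (+-suc ℓ r)))) ⟩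
      y + suc r    ≡⟨ +-suc y r ⟩
      suc y + r    ∎)

    first-rung : ∀ {x r} → suc (x + r) ≡ ℓ → suc (ℓ + r) ≡ ℓ + ℓ → x ≡ 0
    first-rung {x} {r} 1+x+r≡ℓ 1+ℓ+r≡ℓ+ℓ = +-cancelʳ-≡ r x 0
      (suc-injective (trans 1+x+r≡ℓ (sym (+-cancelˡ-≡ ℓ (suc r) ℓ (trans (+-suc ℓ r) 1+ℓ+r≡ℓ+ℓ)))))

    step : ∀ {w w′} → RungView ℓ a w → RungView ℓ (cyc a) w′ → CycView a → LadderStep w w′
    step (bottom a≡i) (bottom a′≡i′) (inner a′≡1+a) =
      right (trans (sym a′≡i′) (trans a′≡1+a (cong suc a≡i)))
    step {i , _} (bottom a≡i) (top a′≡ℓ+r′ 1+i′+r′≡ℓ) (inner a′≡1+a)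
      with refl ← toℕ-injective (last-rung (toℕ<n i) (trans (cong suc (sym a≡i)) (trans (sym a′≡1+a) a′≡ℓ+r′))
                                           1+i′+r′≡ℓ)
      = up
    step {i , _} (bottom a≡i) _ (wrap _ 1+a≡ℓ+ℓ) =
      ⊥-elim (1+x≢ℓ+ℓ (subst (_< ℓ) (sym a≡i) (toℕ<n i)) 1+a≡ℓ+ℓ)
    step (top a≡ℓ+r _) (bottom {i′} a′≡i′) (inner a′≡1+a) =
      ⊥-elim (<⇒≱ (toℕ<n i′) (subst (ℓ ≤_) (trans (sym (cong suc a≡ℓ+r)) (trans (sym a′≡1+a) a′≡i′))
                                           (≤-trans (m≤m+n ℓ _) (n≤1+n _))))
    step (top a≡ℓ+r 1+i+r≡ℓ) (top a′≡ℓ+r′ 1+i′+r′≡ℓ) (inner a′≡1+a) =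
      left (next-rung 1+i+r≡ℓ 1+i′+r′≡ℓ (trans (sym a′≡ℓ+r′) (trans a′≡1+a (cong suc a≡ℓ+r))))
    step {i , _} {i′ , _} (top a≡ℓ+r 1+i+r≡ℓ) (bottom a′≡i′) (wrap a′≡0 1+a≡ℓ+ℓ)
      with refl ← toℕ-injective {i = i} {j = i′}
                    (trans (first-rung 1+i+r≡ℓ (trans (cong suc (sym a≡ℓ+r)) 1+a≡ℓ+ℓ)) (trans (sym a′≡0) a′≡i′))
      = down
    step {i , _} (top _ _) (top a′≡ℓ+r′ _) (wrap a′≡0 _) =
      ⊥-elim (n≮0 (subst (toℕ i <_) (m+n≡0⇒m≡0 ℓ (trans (sym a′≡ℓ+r′) a′≡0)) (toℕ<n i)))

double : ℕ → ℕ
double ℓ = ℓ + ℓ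

private
  toLadder : ∀ ls → FVert (map double ls) → HVert (sum ls)
  toLadder (ℓ ∷ ls) (zero , a)  = map₁ (_↑ˡ sum ls) (Inverse.to (rung ℓ) a)
  toLadder (ℓ ∷ ls) (suc j , a) = map₁ (ℓ ↑ʳ_) (toLadder ls (j , a))

  fromLadder : ∀ ls → HVert (sum ls) → FVert (map double ls)
  fromLadder (ℓ ∷ ls) (q , b) =
    [ (λ i → zero , Inverse.from (rung ℓ) (i , b))
    , (λ r → let (j , a) = fromLadder ls (r , b) in suc j , a)
    ]′ (splitAt ℓ q)

  toLadder-fromLadder : ∀ ls w → toLadder ls (fromLadder ls w) ≡ w
  toLadder-fromLadder (ℓ ∷ ls) (q , b) with splitAt ℓ q in eq
  ... | inj₁ i = trans (cong (map₁ (_↑ˡ sum ls)) (Inverse.strictlyInverseˡ (rung ℓ) (i , b)))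
                       (cong (_, b) (splitAt⁻¹-↑ˡ eq))
  ... | inj₂ r = trans (cong (map₁ (ℓ ↑ʳ_)) (toLadder-fromLadder ls (r , b)))
                       (cong (_, b) (splitAt⁻¹-↑ʳ eq))

  fromLadder-toLadder : ∀ ls p → fromLadder ls (toLadder ls p) ≡ p
  fromLadder-toLadder (ℓ ∷ ls) (zero , a)
    rewrite splitAt-↑ˡ ℓ (proj₁ (Inverse.to (rung ℓ) a)) (sum ls) =
    cong (zero ,_) (Inverse.strictlyInverseʳ (rung ℓ) a)
  fromLadder-toLadder (ℓ ∷ ls) (suc j , a)
    rewrite splitAt-↑ʳ ℓ (sum ls) (proj₁ (toLadder ls (j , a))) =
    cong (λ (j , a) → suc j , a) (fromLadder-toLadder ls (j , a))

ladder : ∀ ls → FVert (map double ls) ↔ HVert (sum ls)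
ladder ls = mk↔ₛ′ (toLadder ls) (fromLadder ls) (toLadder-fromLadder ls) (fromLadder-toLadder ls)

ladder-step : ∀ ls p → LadderStep (Inverse.to (ladder ls) p)
                                  (Inverse.to (ladder ls) (Inverse.to (rotate (map double ls)) p))
ladder-step (ℓ ∷ ls) (zero , a)  = LadderStep-translate 0 (λ q → toℕ-↑ˡ q (sum ls)) (rung-step ℓ a)
ladder-step (ℓ ∷ ls) (suc j , a) = LadderStep-translate ℓ (toℕ-↑ʳ ℓ) (ladder-step ls (j , a))

skew : ∀ {n} → HVert n ↔ HVert n
skew = mk↔ₛ′ (λ (q , b) → (if b then cyc q else q) , b)
             (λ (q , b) → (if b then prd q else q) , b)
             (λ { (q , false) → refl ; (q , true) → cong (_, true) (cyc-prd q) })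
             (λ { (q , false) → refl ; (q , true) → cong (_, true) (prd-cyc q) })

skew-step : ∀ {n} {w w′ : HVert n} → LadderStep w w′ →
            proj₁ (Inverse.to skew w′) ≡ move (proj₂ w) (proj₁ (Inverse.to skew w))
skew-step (right e)        = cyc-unique e
skew-step up               = refl
skew-step (left {q = q} e) = trans (sym (cyc-unique e)) (sym (prd-cyc q))
skew-step (down {q})       = sym (prd-cyc q)

Drifting : ∀ {V n} → (V → V) → V ↔ HVert n → Set
Drifting next ρ = ∀ p → let (i , b) = Inverse.to ρ p in proj₁ (Inverse.to ρ (next p)) ≡ move b i

skewed-ladder-drifting : ∀ ls → Drifting (Inverse.to (rotate (map double ls))) (↔-trans (ladder ls) skew)
skewed-ladder-drifting ls p = skew-step (ladder-step ls p)

-- Switching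

module Switching {n} {V I : Set} (next : V ↔ V) (ρ : V ↔ HVert n)
                 (drifting : Drifting (Inverse.to next) ρ) (s : Fin n → I → Bool) where

  open Inverse using (to; from; strictlyInverseˡ; strictlyInverseʳ)

  σ : HVert n ↔ HVert n
  σ = ↔-trans (↔-sym ρ) (↔-trans next ρ)

  σ-move : ∀ i c → proj₁ (to σ (i , c)) ≡ move c i
  σ-move i c = trans (drifting (from ρ (i , c)))
                     (cong (λ w → move (proj₂ w) (proj₁ w)) (strictlyInverseˡ ρ (i , c)))

  switch : I → HVert n → HVert n
  switch k (i , b) = i , b xor s i k

  switch-involutive : ∀ k w → switch k (switch k w) ≡ w
  switch-involutive k (i , b) = cong (i ,_) (xor-cancelʳ b (s i k))

  switching : I → HVert n ↔ HVert n
  switching k = mk↔ₛ′ (switch k) (switch k) (switch-involutive k) (switch-involutive k)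

  factor : I → HVert n → HVert n
  factor k = switch k ∘ to σ ∘ switch k

  relabel : I → V ↔ HVert n
  relabel k = ↔-trans ρ (switching k)

  relabel-intertwines : ∀ k p → to (relabel k) (to next p) ≡ factor k (to (relabel k) p)
  relabel-intertwines k p = cong (switch k) (begin
    to ρ (to next p)                      ≡⟨ cong (to ρ ∘ to next) (strictlyInverseʳ ρ p) ⟨
    to σ (to ρ p)                         ≡⟨ cong (to σ) (switch-involutive k (to ρ p)) ⟨
    to σ (switch k (switch k (to ρ p)))   ∎)

  factor-arc : ∀ k u → HStarArc n u (factor k u)
  factor-arc k (i , a) = subst (CAdj i) (sym (σ-move i (a xor s i k))) (move-adjacent (a xor s i k) i)

  ∈factor⇔ : ∀ k u v → (v ≡ factor k u) ⇔ (from σ (switch k v) ≡ switch k u)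
  ∈factor⇔ k u v = mk⇔
    (λ e → trans (cong (from σ ∘ switch k) e)
                 (trans (cong (from σ) (switch-involutive k (to σ (switch k u))))
                        (strictlyInverseʳ σ (switch k u))))
    (λ e → trans (sym (switch-involutive k v))
                 (cong (switch k) (trans (sym (strictlyInverseˡ σ (switch k v))) (cong (to σ) e))))

  factor-unique : 3 ≤ n → (∀ {i j} → CAdj i j → ∀ x y → ∃! _≡_ (λ k → s i k ≡ x × s j k ≡ y)) →
                  ∀ u v → HStarArc n u v → ∃! _≡_ (λ k → v ≡ factor k u)
  factor-unique 3≤n complementary (i , a) (j , b) adj
    with c , j≡ ← adjacent⇒move adj = ∃!-cong ∈factor (complementary adj (a xor c) (h xor b))
    where
      h : Bool
      h = proj₂ (to σ (i , c))

      σ-at : to σ (i , c) ≡ (j , h)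
      σ-at = cong (_, h) (trans (σ-move i c) (sym j≡))

      ∈factor : ∀ k → (s i k ≡ a xor c × s j k ≡ h xor b) ⇔ ((j , b) ≡ factor k (i , a))
      ∈factor k = mk⇔ sufficient necessary
        where
          via-c : a xor s i k ≡ c → factor k (i , a) ≡ (j , h xor s j k)
          via-c a⊕sᵢ≡c = trans (cong (λ c′ → switch k (to σ (i , c′))) a⊕sᵢ≡c) (cong (switch k) σ-at)

          sufficient : s i k ≡ a xor c × s j k ≡ h xor b → (j , b) ≡ factor k (i , a)
          sufficient (sᵢ , sⱼ) = sym (begin
            factor k (i , a)        ≡⟨ via-c (trans (cong (a xor_) sᵢ) (xor-cancelˡ a c)) ⟩
            j , h xor s j k         ≡⟨ cong (λ y → j , h xor y) sⱼ ⟩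
            j , h xor (h xor b)     ≡⟨ cong (j ,_) (xor-cancelˡ h b) ⟩
            j , b                   ∎)

          necessary : (j , b) ≡ factor k (i , a) → s i k ≡ a xor c × s j k ≡ h xor b
          necessary e = xor-solve a a⊕sᵢ≡c , xor-solve h (sym (cong proj₂ (trans e (via-c a⊕sᵢ≡c))))
            where
              a⊕sᵢ≡c : a xor s i k ≡ c
              a⊕sᵢ≡c = move-injective 3≤n i
                (trans (sym (σ-move i (a xor s i k))) (trans (sym (cong proj₁ e)) j≡))

flipAtZero : Fin 2 → Bool → Bool
flipAtZero zero       k = k
flipAtZero (suc zero) k = false

module _ {V : Set} (next : V ↔ V) (ρ : V ↔ HVert 2) (drifting : Drifting (Inverse.to next) ρ) where
  open Switching next ρ drifting flipAtZero
  open Inverse using (to; from; strictlyInverseˡ)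

  private
    σ-fibre : ∀ w → proj₁ (to σ w) ≡ cyc (proj₁ w)
    σ-fibre (i , c) = trans (σ-move i c) (move≡cyc₂ c i)

  factor-unique₂ : ∀ u v → HStarArc 2 u v → ∃! _≡_ (λ k → v ≡ factor k u)
  factor-unique₂ (i , a) (j , b) adj with c , j≡ ← adjacent⇒move adj | trans j≡ (move≡cyc₂ c i)
  factor-unique₂ (zero , a) (_ , b) _ | refl = ∃!-cong ∈factor (xor-unique a (proj₂ w₀))
    where
      w₀ : HVert 2
      w₀ = from σ (suc zero , b xor false)

      w₀-at : ∀ x → x ≡ proj₂ w₀ → (zero , x) ≡ w₀
      w₀-at x x≡ = cong₂ _,_ (cyc-injective (trans (cong proj₁ (sym (strictlyInverseˡ σ _))) (σ-fibre w₀))) x≡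

      ∈factor : ∀ k → (a xor k ≡ proj₂ w₀) ⇔ ((suc zero , b) ≡ factor k (zero , a))
      ∈factor k = mk⇔ (λ e → Equivalence.from ∈factor-via-σ⁻¹ (sym (w₀-at _ e)))
                      (λ e → sym (cong proj₂ (Equivalence.to ∈factor-via-σ⁻¹ e)))
        where ∈factor-via-σ⁻¹ = ∈factor⇔ k (zero , a) (suc zero , b)
  factor-unique₂ (suc zero , a) (_ , b) _ | refl = ∃!-cong ∈factor (xor-unique (proj₂ w₁) b)
    where
      w₁ : HVert 2
      w₁ = to σ (suc zero , a xor false)

      factor-at : ∀ k → factor k (suc zero , a) ≡ (zero , proj₂ w₁ xor k)
      factor-at k = cong (λ i → switch k (i , proj₂ w₁)) (σ-fibre (suc zero , a xor false))

      ∈factor : ∀ k → (proj₂ w₁ xor k ≡ b) ⇔ ((zero , b) ≡ factor k (suc zero , a))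
      ∈factor k = mk⇔ (λ e → sym (trans (factor-at k) (cong (zero ,_) e)))
                      (λ e → sym (cong proj₂ (trans e (factor-at k))))

-- Colouring C_n by the nonzero linear forms on 𝔽₂²

data Colour : Set where
  α β γ : Colour

form : Colour → Bool × Bool → Bool
form α (x , y) = x
form β (x , y) = y
form γ (x , y) = x xor y

forms⁻¹ : (c d : Colour) → c ≢ d → Bool → Bool → Bool × Bool
forms⁻¹ α β _ x y = x , y
forms⁻¹ β α _ x y = y , x
forms⁻¹ α γ _ x y = x , x xor y
forms⁻¹ γ α _ x y = y , y xor x
forms⁻¹ β γ _ x y = y xor x , x
forms⁻¹ γ β _ x y = x xor y , y
forms⁻¹ α α c≢d _ _ = ⊥-elim (c≢d refl)
forms⁻¹ β β c≢d _ _ = ⊥-elim (c≢d refl)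
forms⁻¹ γ γ c≢d _ _ = ⊥-elim (c≢d refl)

forms-forms⁻¹ : ∀ (c d : Colour) (c≢d : c ≢ d) x y →
                form c (forms⁻¹ c d c≢d x y) ≡ x × form d (forms⁻¹ c d c≢d x y) ≡ y
forms-forms⁻¹ α β _ x y = refl , refl
forms-forms⁻¹ β α _ x y = refl , refl
forms-forms⁻¹ α γ _ x y = refl , xor-cancelˡ x y
forms-forms⁻¹ γ α _ x y = xor-cancelˡ y x , refl
forms-forms⁻¹ β γ _ x y = refl , xor-cancelʳ y x
forms-forms⁻¹ γ β _ x y = xor-cancelʳ x y , refl
forms-forms⁻¹ α α c≢d _ _ = ⊥-elim (c≢d refl)
forms-forms⁻¹ β β c≢d _ _ = ⊥-elim (c≢d refl)
forms-forms⁻¹ γ γ c≢d _ _ = ⊥-elim (c≢d refl)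

forms⁻¹-forms : ∀ (c d : Colour) (c≢d : c ≢ d) k → forms⁻¹ c d c≢d (form c k) (form d k) ≡ k
forms⁻¹-forms α β _ k = refl
forms⁻¹-forms β α _ k = refl
forms⁻¹-forms α γ _ (x , y) = cong (x ,_) (xor-cancelˡ x y)
forms⁻¹-forms γ α _ (x , y) = cong (x ,_) (xor-cancelˡ x y)
forms⁻¹-forms β γ _ (x , y) = cong (_, y) (xor-cancelʳ x y)
forms⁻¹-forms γ β _ (x , y) = cong (_, y) (xor-cancelʳ x y)
forms⁻¹-forms α α c≢d _ = ⊥-elim (c≢d refl)
forms⁻¹-forms β β c≢d _ = ⊥-elim (c≢d refl)
forms⁻¹-forms γ γ c≢d _ = ⊥-elim (c≢d refl)

forms-unique : ∀ {c d} → c ≢ d → ∀ x y → ∃! _≡_ (λ k → form c k ≡ x × form d k ≡ y)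
forms-unique {c} {d} c≢d x y =
  forms⁻¹ c d c≢d x y , forms-forms⁻¹ c d c≢d x y ,
  λ {k} (cx , dy) → trans (cong₂ (forms⁻¹ c d c≢d) (sym cx) (sym dy)) (forms⁻¹-forms c d c≢d k)

alternating : ℕ → Colour
alternating zero          = α
alternating (suc zero)    = β
alternating (suc (suc k)) = alternating k

alternating≢γ : ∀ k → alternating k ≢ γ
alternating≢γ zero          ()
alternating≢γ (suc zero)    ()
alternating≢γ (suc (suc k)) = alternating≢γ k

alternating-proper : ∀ k → alternating k ≢ alternating (suc k)
alternating-proper zero          ()
alternating-proper (suc zero)    ()
alternating-proper (suc (suc k)) = alternating-proper k

colourℕ : ℕ → Colour
colourℕ zero    = γ
colourℕ (suc k) = alternating k

colourℕ-proper : ∀ t → colourℕ t ≢ colourℕ (suc t)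
colourℕ-proper zero    ()
colourℕ-proper (suc t) = alternating-proper t

colour : ∀ {n} → Fin n → Colour
colour i = colourℕ (toℕ i)

colour-proper : ∀ {n} → 2 ≤ n → (i : Fin n) → colour i ≢ colour (cyc i)
colour-proper {n} 2≤n i with cycView i
... | inner e       = λ same → colourℕ-proper (toℕ i) (trans same (cong colourℕ e))
... | wrap e 1+i≡n  = λ same → not-last (toℕ i) 1+i≡n (trans same (cong colourℕ e))
  where
    not-last : ∀ t → suc t ≡ n → colourℕ t ≢ γ
    not-last zero    1≡n = ⊥-elim (<-irrefl 1≡n 2≤n)
    not-last (suc t) _   = alternating≢γ t

colour-adjacent : ∀ {n} → 2 ≤ n → {i j : Fin n} → CAdj i j → colour i ≢ colour j
colour-adjacent 2≤n {i}     (inj₁ refl) = colour-proper 2≤n i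
colour-adjacent 2≤n {j = j} (inj₂ refl) = ≢-sym (colour-proper 2≤n j)

drifting-factorization : ∀ {n} {V : Set} {F : Digraph V} (next : V ↔ V) →
                         (∀ p q → F p q ⇔ (q ≡ Inverse.to next p)) →
                         (ρ : V ↔ HVert n) → Drifting (Inverse.to next) ρ → 2 ≤ n →
                         Factorization (HStarArc n) F
drifting-factorization {suc (suc zero)} next F⇔next ρ drifting _ =
  functional-factorization (Inverse.to next) F⇔next 2↔Bool factor relabel relabel-intertwines factor-arc
    (factor-unique₂ next ρ drifting)
  where open Switching next ρ drifting flipAtZero
drifting-factorization {suc (suc (suc _))} next F⇔next ρ drifting 2≤n =
  functional-factorization (Inverse.to next) F⇔next (↔-trans *↔× (2↔Bool ×-↔ 2↔Bool))
    factor relabel relabel-intertwines factor-arc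
    (factor-unique (s≤s (s≤s (s≤s z≤n))) (λ adj → forms-unique (colour-adjacent 2≤n adj)))
  where open Switching next ρ drifting (form ∘ colour)
drifting-factorization {suc zero} _ _ _ _ (s≤s ())

ladder-factorization : ∀ ls → 2 ≤ sum ls → Factorization (HStarArc (sum ls)) (FArc (map double ls))
ladder-factorization ls = drifting-factorization (rotate (map double ls)) (FArc⇔rotate (map double ls))
                                                 (↔-trans (ladder ls) skew) (skewed-ladder-drifting ls)

halve : ∀ ms → All (λ k → 2 ∣ k) ms → ∃ λ ls → ms ≡ map double ls
halve []       []                     = [] , refl
halve (_ ∷ ms) (divides ℓ refl ∷ evens) with ls , refl ← halve ms evens =
  ℓ ∷ ls , cong (_∷ map double ls) (trans (*-suc ℓ 1) (cong (ℓ +_) (*-identityʳ ℓ)))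

sum-map-double : ∀ ls → sum (map double ls) ≡ 2 * sum ls
sum-map-double []       = refl
sum-map-double (ℓ ∷ ls) = begin
  double ℓ + sum (map double ls)   ≡⟨ cong (double ℓ +_) (sum-map-double ls) ⟩
  (ℓ + ℓ) + 2 * sum ls             ≡⟨ cong (λ x → (ℓ + x) + 2 * sum ls) (+-identityʳ ℓ) ⟨
  2 * ℓ + 2 * sum ls               ≡⟨ *-distribˡ-+ 2 ℓ (sum ls) ⟨
  2 * (ℓ + sum ls)                 ∎

lemma3p3 : (m : ℕ) → 1 < m → (ms : List ℕ)
    → All (λ k → 2 ≤ k) ms → All (λ k → 2 ∣ k) ms
    → Sorted ≤-totalOrder ms
    → sum ms ≡ 2 * m
    → 2 ∈ ms
    → Factorization (HStarArc m) (FArc ms)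
lemma3p3 m 1<m ms _ evens _ Σms≡2m _ with ls , refl ← halve ms evens
  with refl ← *-cancelˡ-≡ (sum ls) m 2 (trans (sym (sum-map-double ls)) Σms≡2m) =
  ladder-factorization ls 1<m
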